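{- Let $\mathcal{M}$ be a structure over a finite relational vocabulary and let $\xi(x,y)$ be the equivalence relation on $M$ holding of $a,b$ iff $a$ and $b$ satisfy the same atomic diagram (as one-element substructures). If $\mathcal{M}$ is $k$-unavoidably homogenizable, then for each infinite equivalence class $A$ of $\xi$, the substructure $\mathcal{M}\upharpoonright A$ is $k$-unavoidably homogenizable.
   Context: $\mathcal{M}\upharpoonright A$ is the substructure with universe $A$. For a structure $\mathcal{N}$, $tp(\bar a)$ is the complete type of $\bar a$ over $\emptyset$ in $\mathcal{N}$; it is isolated by a quantifier-free formula if some quantifier-free formula true of $\bar a$ implies in $\mathcal{N}$ every formula of $tp(\bar a)$. A structure is $k$-unavoidably homogenizable ($k\in\mathbb{N}$) if for each $n\ge k$, every complete $n$-type of $n$-tuples in it is isolated by a quantifier-free formula. -}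

module Defs where

open import Data.Nat using (ℕ; _≤_)
open import Data.Fin using (Fin)
open import Data.Product using (Σ; _×_; _,_; proj₁; proj₂)
open import Data.Sum using (_⊎_)
open import Data.Unit using (⊤)
open import Data.Empty using (⊥)
open import Relation.Nullary using (¬_)
open import Relation.Binary.PropositionalEquality using (_≡_)
open import Relation.Binary.Structures using (IsEquivalence)
open import Function using (_∘_)

-- Finite relational vocabulary: r relation symbols, symbol i has arity ar i.

-- The carrier comes with the
-- relation ≈ interpreting equality (a setoid; this lets substructures be
-- carried by Σ-types without proof-relevance issues).
record Structure {r : ℕ} (ar : Fin r → ℕ) : Set₁ where
  field
    Carrier : Set
    _≈_     : Carrier → Carrier → Set
    isEquiv : IsEquivalence _≈_
    rel     : (i : Fin r) → (Fin (ar i) → Carrier) → Set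
    rel-resp : ∀ i (u v : Fin (ar i) → Carrier) →
               (∀ j → u j ≈ v j) → rel i u → rel i v

open Structure public

-- First-order formulas (with equality) in n free variables, de Bruijn style.

data Formula {r : ℕ} (ar : Fin r → ℕ) : ℕ → Set where
  atomR : ∀ {n} (i : Fin r) → (Fin (ar i) → Fin n) → Formula ar n
  atomE : ∀ {n} → Fin n → Fin n → Formula ar n
  tt ff : ∀ {n} → Formula ar n
  neg   : ∀ {n} → Formula ar n → Formula ar n
  _∧′_ _∨′_ _⇒′_ : ∀ {n} → Formula ar n → Formula ar n → Formula ar n
  all ex : ∀ {n} → Formula ar (ℕ.suc n) → Formula ar n

data QF {r : ℕ} {ar : Fin r → ℕ} : ∀ {n} → Formula ar n → Set where
  qf-atomR : ∀ {n} i (t : Fin (ar i) → Fin n) → QF (atomR i t)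
  qf-atomE : ∀ {n} (x y : Fin n) → QF (atomE x y)
  qf-tt    : ∀ {n} → QF (tt {n = n})
  qf-ff    : ∀ {n} → QF (ff {n = n})
  qf-neg   : ∀ {n} {φ : Formula ar n} → QF φ → QF (neg φ)
  qf-∧     : ∀ {n} {φ ψ : Formula ar n} → QF φ → QF ψ → QF (φ ∧′ ψ)
  qf-∨     : ∀ {n} {φ ψ : Formula ar n} → QF φ → QF ψ → QF (φ ∨′ ψ)
  qf-⇒     : ∀ {n} {φ ψ : Formula ar n} → QF φ → QF ψ → QF (φ ⇒′ ψ)

extend : ∀ {A : Set} {n} → A → (Fin n → A) → Fin (ℕ.suc n) → A
extend a ρ Fin.zero    = a
extend a ρ (Fin.suc x) = ρ x

Sat : ∀ {r} {ar : Fin r → ℕ} (M : Structure ar) {n} →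
      Formula ar n → (Fin n → Carrier M) → Set
Sat M (atomR i t) ρ = rel M i (ρ ∘ t)
Sat M (atomE x y) ρ = _≈_ M (ρ x) (ρ y)
Sat M tt ρ = ⊤
Sat M ff ρ = ⊥
Sat M (neg φ) ρ = ¬ Sat M φ ρ
Sat M (φ ∧′ ψ) ρ = Sat M φ ρ × Sat M ψ ρ
Sat M (φ ∨′ ψ) ρ = Sat M φ ρ ⊎ Sat M ψ ρ
Sat M (φ ⇒′ ψ) ρ = Sat M φ ρ → Sat M ψ ρ
Sat M (all φ) ρ = ∀ a → Sat M φ (extend a ρ)
Sat M (ex φ) ρ = Σ (Carrier M) λ a → Sat M φ (extend a ρ)

TpIsolatedByQF : ∀ {r} {ar : Fin r → ℕ} (M : Structure ar) (n : ℕ) →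
                 (Fin n → Carrier M) → Set
TpIsolatedByQF {ar = ar} M n a =
  Σ (Formula ar n) λ ψ → QF ψ × Sat M ψ a ×
    (∀ (φ : Formula ar n) → Sat M φ a →
       ∀ (b : Fin n → Carrier M) → Sat M ψ b → Sat M φ b)

UnavoidablyHomogenizable : ∀ {r} {ar : Fin r → ℕ} → ℕ → Structure ar → Set
UnavoidablyHomogenizable k M =
  ∀ (n : ℕ) → k ≤ n → ∀ (a : Fin n → Carrier M) → TpIsolatedByQF M n a

_↾_ : ∀ {r} {ar : Fin r → ℕ} (M : Structure ar) → (Carrier M → Set) → Structure ar
M ↾ P = record
  { Carrier = Σ (Carrier M) P
  ; _≈_ = λ x y → _≈_ M (proj₁ x) (proj₁ y)
  ; isEquiv = record
      { refl = IsEquivalence.refl (isEquiv M)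
      ; sym = IsEquivalence.sym (isEquiv M)
      ; trans = IsEquivalence.trans (isEquiv M) }
  ; rel = λ i u → rel M i (proj₁ ∘ u)
  ; rel-resp = λ i u v eq → rel-resp M i (proj₁ ∘ u) (proj₁ ∘ v) eq
  }

-- ξ(a,b): a and b have the same atomic diagram as one-element substructures,
-- i.e. agree on every atomic formula R_i(x,…,x) (x = x holds for both).
ξ : ∀ {r} {ar : Fin r → ℕ} (M : Structure ar) → Carrier M → Carrier M → Set
ξ M a b = ∀ i → (rel M i (λ _ → a) → rel M i (λ _ → b)) ×
                (rel M i (λ _ → b) → rel M i (λ _ → a))

Infinite : ∀ {r} {ar : Fin r → ℕ} (M : Structure ar) → (Carrier M → Set) → Set
Infinite M P = Σ (ℕ → Carrier M) λ f → (∀ m → P (f m)) ×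
  (∀ m n → _≈_ M (f m) (f n) → m ≡ n)

module Submission where

-- Let A be a class of ξ and a₀ ∈ A.  Membership in A is
-- uniformly definable from any of its own elements: x ∈ A iff ξ(x, y)
-- for some (any) y ∈ A, and ξ(x, y) is the finite conjunction over the
-- relation symbols R of  R(x,…,x) ↔ R(y,…,y).  So a formula φ about
-- M ↾ A can be relativized to a formula φᴬ about M, using one of the free
-- variables as the parameter that pins down A (each quantifier ∀z/∃z is
-- guarded by ξ(z, v)).  Relativization leaves quantifier-free formulas
-- unchanged.  Hence if ψ isolates tp(ā) in M, it also isolates tp(ā) in
-- M ↾ A: if φ holds of ā in M ↾ A, then φᴬ holds of ā in M, so φᴬ holds
-- of every b̄ satisfying ψ, so φ holds of b̄ in M ↾ A.  Empty tuples need
-- no parameter, since all of them have the same type.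

open import Defs
open import Data.Nat using (ℕ; zero; suc)
open import Data.Fin using (Fin)
open import Data.Fin.Properties using (∀-cons-⇔)
open import Data.Product using (Σ; _,_; proj₁; proj₂)
open import Data.Product.Function.NonDependent.Propositional using (_×-⇔_)
open import Data.Sum.Function.Propositional using (_⊎-⇔_)
open import Data.Unit using (tt)
open import Function using (_∘_)
open import Function.Bundles using (_⇔_; mk⇔; module Equivalence)
open import Function.Construct.Identity using (⇔-id)
open import Function.Construct.Composition using (_⇔-∘_)
open import Function.Related.TypeIsomorphisms using (¬-cong-⇔; →-cong-⇔)
open import Relation.Binary.PropositionalEquality using (_≡_; refl; cong; cong₂; subst)
open import Relation.Binary.Structures using (IsEquivalence)

open Equivalence using (to; from)

module _ {r : ℕ} {ar : Fin r → ℕ} where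

  Agree : (M : Structure ar) {n : ℕ} → (Fin n → Carrier M) → (Fin n → Carrier M) → Set
  Agree M σ τ = ∀ j → _≈_ M (σ j) (τ j)

  extend-agree : (M : Structure ar) {n : ℕ} {σ τ : Fin n → Carrier M} →
    (x : Carrier M) → Agree M σ τ → Agree M (extend x σ) (extend x τ)
  extend-agree M x e Fin.zero    = IsEquivalence.refl (isEquiv M)
  extend-agree M x e (Fin.suc j) = e j

  module Atoms (M : Structure ar) {n : ℕ} {σ τ : Fin n → Carrier M}
               (e : Agree M σ τ) where
    open IsEquivalence (isEquiv M)

    atomR-cong : ∀ i (t : Fin (ar i) → Fin n) → rel M i (σ ∘ t) ⇔ rel M i (τ ∘ t)
    atomR-cong i t = mk⇔ (rel-resp M i _ _ (e ∘ t)) (rel-resp M i _ _ (sym ∘ e ∘ t))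

    atomE-cong : ∀ (x y : Fin n) → _≈_ M (σ x) (σ y) ⇔ _≈_ M (τ x) (τ y)
    atomE-cong x y = mk⇔ (λ p → trans (sym (e x)) (trans p (e y)))
                         (λ p → trans (e x) (trans p (sym (e y))))

  -- Satisfaction is invariant under replacing an assignment by a pointwise
  -- ≈-equal one.  Needed to see that all empty tuples have the same type.
  Sat-cong : (M : Structure ar) {n : ℕ} (φ : Formula ar n) {σ τ : Fin n → Carrier M} →
    Agree M σ τ → Sat M φ σ ⇔ Sat M φ τ
  Sat-cong M (atomR i t) e = Atoms.atomR-cong M e i t
  Sat-cong M (atomE x y) e = Atoms.atomE-cong M e x y
  Sat-cong M tt        e = ⇔-id _
  Sat-cong M ff        e = ⇔-id _
  Sat-cong M (neg φ)   e = ¬-cong-⇔ (Sat-cong M φ e)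
  Sat-cong M (φ ∧′ ψ)  e = Sat-cong M φ e ×-⇔ Sat-cong M ψ e
  Sat-cong M (φ ∨′ ψ)  e = Sat-cong M φ e ⊎-⇔ Sat-cong M ψ e
  Sat-cong M (φ ⇒′ ψ)  e = →-cong-⇔ (Sat-cong M φ e) (Sat-cong M ψ e)
  Sat-cong M (all φ)   e = mk⇔ (λ f x → to (Sat-cong M φ (extend-agree M x e)) (f x))
                               (λ f x → from (Sat-cong M φ (extend-agree M x e)) (f x))
  Sat-cong M (ex φ)    e = mk⇔ (λ (x , p) → x , to (Sat-cong M φ (extend-agree M x e)) p)
                               (λ (x , p) → x , from (Sat-cong M φ (extend-agree M x e)) p)

  empty-tuple-isolated : (N : Structure ar) (ā : Fin 0 → Carrier N) → TpIsolatedByQF N 0 ā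
  empty-tuple-isolated N ā = tt , qf-tt , tt , λ φ p b _ → to (Sat-cong N φ (λ ())) p

  record DefinableClass (M : Structure ar) (P : Carrier M → Set) : Set where
    field
      δ         : ∀ {n} → Fin n → Fin n → Formula ar n
      δ-defines : ∀ {n} (x y : Fin n) (ρ : Fin n → Carrier M) →
                  P (ρ y) → Sat M (δ x y) ρ ⇔ P (ρ x)
      P-resp    : ∀ {a b} → _≈_ M a b → P a → P b

  module Relativization (M : Structure ar) {P : Carrier M → Set}
                        (D : DefinableClass M P) where
    open DefinableClass D
    open IsEquivalence (isEquiv M) renaming (refl to ≈-refl; sym to ≈-sym)

    N : Structure ar
    N = M ↾ P

    relativize : ∀ {n} → Fin n → Formula ar n → Formula ar n
    relativize v (atomR i t) = atomR i t
    relativize v (atomE x y) = atomE x y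
    relativize v tt          = tt
    relativize v ff          = ff
    relativize v (neg φ)     = neg (relativize v φ)
    relativize v (φ ∧′ ψ)    = relativize v φ ∧′ relativize v ψ
    relativize v (φ ∨′ ψ)    = relativize v φ ∨′ relativize v ψ
    relativize v (φ ⇒′ ψ)    = relativize v φ ⇒′ relativize v ψ
    relativize v (all φ)     = all (δ Fin.zero (Fin.suc v) ⇒′ relativize (Fin.suc v) φ)
    relativize v (ex φ)      = ex (δ Fin.zero (Fin.suc v) ∧′ relativize (Fin.suc v) φ)

    relativize-QF : ∀ {n} (v : Fin n) {ψ : Formula ar n} → QF ψ → relativize v ψ ≡ ψ
    relativize-QF v (qf-atomR i t) = refl
    relativize-QF v (qf-atomE x y) = refl
    relativize-QF v qf-tt          = refl
    relativize-QF v qf-ff          = refl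
    relativize-QF v (qf-neg q)     = cong neg (relativize-QF v q)
    relativize-QF v (qf-∧ q₁ q₂)   = cong₂ _∧′_ (relativize-QF v q₁) (relativize-QF v q₂)
    relativize-QF v (qf-∨ q₁ q₂)   = cong₂ _∨′_ (relativize-QF v q₁) (relativize-QF v q₂)
    relativize-QF v (qf-⇒ q₁ q₂)   = cong₂ _⇒′_ (relativize-QF v q₁) (relativize-QF v q₂)

    extend-agree-↾ : ∀ {n} {σ : Fin n → Carrier M} {ρ : Fin n → Σ (Carrier M) P} →
      Agree M σ (proj₁ ∘ ρ) → (x : Σ (Carrier M) P) →
      Agree M (extend (proj₁ x) σ) (proj₁ ∘ extend x ρ)
    extend-agree-↾ e x Fin.zero    = ≈-refl
    extend-agree-↾ e x (Fin.suc j) = e j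

    -- The guard of a relativized quantifier carves out exactly P, because
    -- the parameter σ v is (≈ to) an element of P.
    guard-defines-P : ∀ {n} (v : Fin n) (σ : Fin n → Carrier M) (ρ : Fin n → Σ (Carrier M) P) →
      Agree M σ (proj₁ ∘ ρ) → (x : Carrier M) →
      Sat M (δ Fin.zero (Fin.suc v)) (extend x σ) ⇔ P x
    guard-defines-P v σ ρ e x =
      δ-defines Fin.zero (Fin.suc v) (extend x σ) (P-resp (≈-sym (e v)) (proj₂ (ρ v)))

    relativize-correct : ∀ {n} (v : Fin n) (φ : Formula ar n)
      (σ : Fin n → Carrier M) (ρ : Fin n → Σ (Carrier M) P) →
      Agree M σ (proj₁ ∘ ρ) → Sat M (relativize v φ) σ ⇔ Sat N φ ρ
    relativize-correct v (atomR i t) σ ρ e = Atoms.atomR-cong M e i t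
    relativize-correct v (atomE x y) σ ρ e = Atoms.atomE-cong M e x y
    relativize-correct v tt       σ ρ e = ⇔-id _
    relativize-correct v ff       σ ρ e = ⇔-id _
    relativize-correct v (neg φ)  σ ρ e = ¬-cong-⇔ (relativize-correct v φ σ ρ e)
    relativize-correct v (φ ∧′ ψ) σ ρ e =
      relativize-correct v φ σ ρ e ×-⇔ relativize-correct v ψ σ ρ e
    relativize-correct v (φ ∨′ ψ) σ ρ e =
      relativize-correct v φ σ ρ e ⊎-⇔ relativize-correct v ψ σ ρ e
    relativize-correct v (φ ⇒′ ψ) σ ρ e =
      →-cong-⇔ (relativize-correct v φ σ ρ e) (relativize-correct v ψ σ ρ e)
    relativize-correct v (all φ) σ ρ e = mk⇔
      (λ f x → to (ih x) (f (proj₁ x) (from (guard-defines-P v σ ρ e (proj₁ x)) (proj₂ x))))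
      (λ g x d → from (ih (x , to (guard-defines-P v σ ρ e x) d)) (g _))
      where
        ih : (x : Σ (Carrier M) P) →
          Sat M (relativize (Fin.suc v) φ) (extend (proj₁ x) σ) ⇔ Sat N φ (extend x ρ)
        ih x = relativize-correct (Fin.suc v) φ (extend (proj₁ x) σ) (extend x ρ)
                 (extend-agree-↾ e x)
    relativize-correct v (ex φ) σ ρ e = mk⇔
      (λ (x , d , p) → (x , to (guard-defines-P v σ ρ e x) d) , to (ih _) p)
      (λ (x , p) → proj₁ x , from (guard-defines-P v σ ρ e (proj₁ x)) (proj₂ x) , from (ih x) p)
      where
        ih : (x : Σ (Carrier M) P) →
          Sat M (relativize (Fin.suc v) φ) (extend (proj₁ x) σ) ⇔ Sat N φ (extend x ρ)
        ih x = relativize-correct (Fin.suc v) φ (extend (proj₁ x) σ) (extend x ρ)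
                 (extend-agree-↾ e x)

    relativize-absolute : ∀ {n} (v : Fin n) (φ : Formula ar n) (ρ : Fin n → Σ (Carrier M) P) →
      Sat M (relativize v φ) (proj₁ ∘ ρ) ⇔ Sat N φ ρ
    relativize-absolute v φ ρ = relativize-correct v φ (proj₁ ∘ ρ) ρ (λ _ → ≈-refl)

    QF-absolute : ∀ {m} {ψ : Formula ar (suc m)} → QF ψ → (ρ : Fin (suc m) → Σ (Carrier M) P) →
      Sat M ψ (proj₁ ∘ ρ) ⇔ Sat N ψ ρ
    QF-absolute {ψ = ψ} q ρ =
      subst (λ θ → Sat M θ (proj₁ ∘ ρ) ⇔ Sat N ψ ρ) (relativize-QF Fin.zero q)
            (relativize-absolute Fin.zero ψ ρ)

    isolation-restricts : ∀ {m} (ā : Fin (suc m) → Σ (Carrier M) P) →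
      TpIsolatedByQF M (suc m) (proj₁ ∘ ā) → TpIsolatedByQF N (suc m) ā
    isolation-restricts ā (ψ , qψ , ψā , isolates) =
      ψ , qψ , to (QF-absolute qψ ā) ψā ,
      λ φ φā b̄ ψb̄ → to (relativize-absolute Fin.zero φ b̄)
        (isolates (relativize Fin.zero φ) (from (relativize-absolute Fin.zero φ ā) φā)
                  (proj₁ ∘ b̄) (from (QF-absolute qψ b̄) ψb̄))

    homogenizable-restricts : ∀ k → UnavoidablyHomogenizable k M → UnavoidablyHomogenizable k N
    homogenizable-restricts k H zero    k≤n ā = empty-tuple-isolated N ā
    homogenizable-restricts k H (suc m) k≤n ā = isolation-restricts ā (H (suc m) k≤n (proj₁ ∘ ā))

  ⋀ : ∀ {m n} → (Fin m → Formula ar n) → Formula ar n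
  ⋀ {zero}  f = tt
  ⋀ {suc m} f = f Fin.zero ∧′ ⋀ (f ∘ Fin.suc)

  ⋀-sat : (M : Structure ar) {m n : ℕ} (f : Fin m → Formula ar n) (ρ : Fin n → Carrier M) →
    Sat M (⋀ f) ρ ⇔ (∀ j → Sat M (f j) ρ)
  ⋀-sat M {zero}  f ρ = mk⇔ (λ _ ()) (λ _ → tt)
  ⋀-sat M {suc m} f ρ = ∀-cons-⇔ ⇔-∘ (⇔-id _ ×-⇔ ⋀-sat M (f ∘ Fin.suc) ρ)

  ξ-formula : ∀ {n} → Fin n → Fin n → Formula ar n
  ξ-formula x y = ⋀ λ i → (atomR i (λ _ → x) ⇒′ atomR i (λ _ → y))
                       ∧′ (atomR i (λ _ → y) ⇒′ atomR i (λ _ → x))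

  module _ (M : Structure ar) where

    ξ-sym : ∀ {a b} → ξ M a b → ξ M b a
    ξ-sym h i = proj₂ (h i) , proj₁ (h i)

    ξ-trans : ∀ {a b c} → ξ M a b → ξ M b c → ξ M a c
    ξ-trans h g i = proj₁ (g i) ∘ proj₁ (h i) , proj₂ (h i) ∘ proj₂ (g i)

    ξ-≈ : ∀ {a b} → _≈_ M a b → ξ M a b
    ξ-≈ e i = rel-resp M i _ _ (λ _ → e)
            , rel-resp M i _ _ (λ _ → IsEquivalence.sym (isEquiv M) e)

    ξ-class-definable : (a : Carrier M) → DefinableClass M (ξ M a)
    ξ-class-definable a = record
      { δ         = ξ-formula
      ; δ-defines = λ x y ρ ay → same-class ay ⇔-∘ ⋀-sat M _ ρ
      ; P-resp    = λ e ab → ξ-trans ab (ξ-≈ e)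
      }
      where
        same-class : ∀ {x y} → ξ M a y → ξ M x y ⇔ ξ M a x
        same-class ay = mk⇔ (λ xy → ξ-trans ay (ξ-sym xy)) (λ ax → ξ-trans (ξ-sym ax) ay)

proposition5p4 : ∀ {r : ℕ} (ar : Fin r → ℕ) (M : Structure ar) (k : ℕ) →
    UnavoidablyHomogenizable k M →
    ∀ (a : Carrier M) → Infinite M (ξ M a) →
    UnavoidablyHomogenizable k (M ↾ ξ M a)
proposition5p4 ar M k H a _ =
  Relativization.homogenizable-restricts M (ξ-class-definable M a) k H
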